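{- Suppose that $1/n \ll \alpha\ll \xi\ll 1$. Let $G$ be a bipartite graph on $(A,B)$ with $|A|=|B|=n$ and $\delta(G)\geq (1/2+4\xi)n$. For every vertex $v\in V(G)$, let $n_v\in \mathbb{N}$ be such that $(\xi-\alpha)n\leq n_v\leq (\xi+\alpha)n$, and suppose $\sum_{a\in A}n_a=\sum_{b\in B}n_b$. Then $G$ contains a spanning subgraph $G'$ such that $d_{G'}(v)=n_v$ for every $v\in V(G)$.
   Context: Hierarchy notation: $a\ll b$ means there is an increasing function $f$ such that the statement holds whenever $a\le f(b)$; constants are chosen from right to left. -}

module Defs where

open import Data.Nat using (ℕ)
open import Data.Fin using (Fin)
open import Data.Bool using (Bool; true)
open import Data.List using (List; filter; length; map)
open import Data.Nat.ListAction using (sum)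
open import Data.Product using (_×_)
open import Data.List using () renaming (allFin to finList)
open import Data.Integer using (+_)
open import Data.Rational using (ℚ; _/_)
open import Relation.Binary.PropositionalEquality using (_≡_)

-- A bipartite graph on parts A = Fin n and B = Fin n, given by its
-- biadjacency matrix: G a b ≡ true iff a ∈ A is adjacent to b ∈ B.
BipGraph : ℕ → Set
BipGraph n = Fin n → Fin n → Bool

ℕ→ℚ : ℕ → ℚ
ℕ→ℚ m = + m / 1

count : ∀ {n} → (Fin n → Bool) → ℕ
count {n} f = length (filter (λ i → Data.Bool._≟_ (f i) true) (finList n))

degA : ∀ {n} → BipGraph n → Fin n → ℕ
degA G a = count (λ b → G a b)

degB : ∀ {n} → BipGraph n → Fin n → ℕ
degB G b = count (λ a → G a b)

MinDegAtLeast : ∀ {n} → BipGraph n → ℚ → Set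
MinDegAtLeast {n} G d =
  (∀ a → Data.Rational._≤_ d (ℕ→ℚ (degA G a))) × (∀ b → Data.Rational._≤_ d (ℕ→ℚ (degB G b)))

SubgraphOf : ∀ {n} → BipGraph n → BipGraph n → Set
SubgraphOf H G = ∀ a b → H a b ≡ true → G a b ≡ true

sumFin : ∀ {n} → (Fin n → ℕ) → ℕ
sumFin {n} f = sum (map f (finList n))

-- Greedy augmentation. Call H ⊆ G feasible if d_H(v) ≤ n_v for every vertex. Starting from the
-- empty graph, while some a ∈ A is deficient (and hence, as Σ n_a = Σ n_b, some b ∈ B is too),
-- either a has a deficient neighbour y with ay ∈ G ∖ H (add ay), or there is a path a y x b with
-- ay, xb ∈ G ∖ H and xy ∈ H (switch it); either way H gains one edge. If neither applies, let
-- N = N_G(a) ∖ N_H(a) and M = N_G(b) ∖ N_H(b): every y ∈ N is saturated and H has no edge between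
-- M and N, so |N|(ξ − α)n ≤ Σ_{y∈N} n_y ≤ Σ_{x∉M} n_x ≤ (n − |M|)(ξ + α)n, while the minimum
-- degree forces |N|, |M| ≥ (1/2 + 3ξ − α)n. For 0 < α ≤ ξ² ≤ ξ ≤ 1 these bounds are incompatible,
-- so the constants ξ₀ = 1, α₀ = ξ² and n₀ = 0 work.

module Submission where

open import Defs
open import Data.Nat using (ℕ)
open import Data.Fin using (Fin)

module FinSum where
  open import Data.Nat
  open import Data.Nat.Properties
  open import Data.Nat.ListAction as List using ()
  open import Data.Bool using (Bool; true; false; not; _∧_)
  import Data.Bool as Bool
  open import Data.Fin using (zero; suc; punchIn)
  open import Data.Fin.Properties using (any?; punchInᵢ≢i) renaming (_≟_ to _≟ᶠ_)
  open import Data.List using (filter; length; tabulate)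
  open import Data.List.Properties using (map-tabulate)
  open import Data.Product using (∃; _,_)
  open import Function using (_∘_; id)
  open import Relation.Binary.PropositionalEquality
  open import Relation.Nullary using (yes; no; does; contradiction)
  open import Algebra.Properties.Semiring.Sum +-*-semiring public
    using (sum; sum-cong-≗; sum-remove; sum-replicate-zero; ∑-distrib-+; ∑-comm; *-distribˡ-sum)

  private variable
    n : ℕ

  𝟙 : Bool → ℕ
  𝟙 true = 1
  𝟙 false = 0

  𝟙*-≤ : ∀ b m → 𝟙 b * m ≤ m
  𝟙*-≤ true m = ≤-reflexive (+-identityʳ m)
  𝟙*-≤ false m = z≤n

  δ : Fin n → Fin n → ℕ
  δ k i = 𝟙 (does (i ≟ᶠ k))

  δ-self : (k : Fin n) → δ k k ≡ 1
  δ-self k with k ≟ᶠ k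
  ... | yes _ = refl
  ... | no k≢k = contradiction refl k≢k

  δ-other : {k i : Fin n} → i ≢ k → δ k i ≡ 0
  δ-other {k = k} {i} i≢k with i ≟ᶠ k
  ... | yes i≡k = contradiction i≡k i≢k
  ... | no _ = refl

  sum-tabulate : (f : Fin n → ℕ) → List.sum (tabulate f) ≡ sum f
  sum-tabulate {zero} f = refl
  sum-tabulate {suc n} f = cong (f zero +_) (sum-tabulate (f ∘ suc))

  sumFin≡sum : (f : Fin n → ℕ) → sumFin f ≡ sum f
  sumFin≡sum f = trans (cong List.sum (map-tabulate id f)) (sum-tabulate f)

  count-tabulate : ∀ {m} (f : Fin m → Bool) (g : Fin n → Fin m) →
    length (filter (λ i → f i Bool.≟ true) (tabulate g)) ≡ sum (𝟙 ∘ f ∘ g)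
  count-tabulate {zero} f g = refl
  count-tabulate {suc n} f g with f (g zero)
  ... | true = cong suc (count-tabulate f (g ∘ suc))
  ... | false = count-tabulate f (g ∘ suc)

  count≡sum : (f : Fin n → Bool) → count f ≡ sum (𝟙 ∘ f)
  count≡sum f = count-tabulate f id

  sum-mono-≤ : {f g : Fin n → ℕ} → (∀ i → f i ≤ g i) → sum f ≤ sum g
  sum-mono-≤ {zero} f≤g = z≤n
  sum-mono-≤ {suc n} f≤g = +-mono-≤ (f≤g zero) (sum-mono-≤ (f≤g ∘ suc))

  sum-mono-< : {f g : Fin n → ℕ} → (∀ i → f i ≤ g i) → ∀ k → f k < g k → sum f < sum g
  sum-mono-< f≤g zero fk<gk = +-mono-<-≤ fk<gk (sum-mono-≤ (f≤g ∘ suc))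
  sum-mono-< f≤g (suc k) fk<gk = +-mono-≤-< (f≤g zero) (sum-mono-< (f≤g ∘ suc) k fk<gk)

  sum-≡⇒≗ : {f g : Fin n → ℕ} → (∀ i → f i ≤ g i) → sum f ≡ sum g → ∀ i → f i ≡ g i
  sum-≡⇒≗ f≤g eq i = ≤-antisym (f≤g i) (≮⇒≥ λ fi<gi → <-irrefl eq (sum-mono-< f≤g i fi<gi))

  sum-<⇒∃< : {f g : Fin n → ℕ} → sum f < sum g → ∃ λ i → f i < g i
  sum-<⇒∃< {f = f} {g} sf<sg with any? (λ i → f i <? g i)
  ... | yes witness = witness
  ... | no none = contradiction (sum-mono-≤ (λ i → ≮⇒≥ (λ lt → none (i , lt)))) (<⇒≱ sf<sg)

  sum-agree-off : {f g : Fin n → ℕ} (k : Fin n) → (∀ i → i ≢ k → f i ≡ g i) → sum f + g k ≡ sum g + f k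
  sum-agree-off {suc n} {f} {g} k f≡g = begin
    sum f + g k                            ≡⟨ cong (_+ g k) (sum-remove {i = k} f) ⟩
    f k + sum (f ∘ punchIn k) + g k        ≡⟨ cong (λ s → f k + s + g k) rest ⟩
    f k + sum (g ∘ punchIn k) + g k        ≡⟨ +-comm (f k + _) (g k) ⟩
    g k + (f k + sum (g ∘ punchIn k))      ≡⟨ cong (g k +_) (+-comm (f k) _) ⟩
    g k + (sum (g ∘ punchIn k) + f k)      ≡⟨ +-assoc (g k) _ (f k) ⟨
    g k + sum (g ∘ punchIn k) + f k        ≡⟨ cong (_+ f k) (sum-remove {i = k} g) ⟨
    sum g + f k                            ∎
    where
    open ≡-Reasoning
    rest : sum (f ∘ punchIn k) ≡ sum (g ∘ punchIn k)
    rest = sum-cong-≗ (λ i → f≡g (punchIn k i) (punchInᵢ≢i k i))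

  sum-δ : (k : Fin n) → sum (δ k) ≡ 1
  sum-δ {n} k = begin
    sum (δ k)                    ≡⟨ +-identityʳ _ ⟨
    sum (δ k) + 0                ≡⟨ sum-agree-off {f = δ k} {g = λ _ → 0} k (λ i → δ-other) ⟩
    sum {n} (λ _ → 0) + δ k k    ≡⟨ cong₂ _+_ (sum-replicate-zero n) (δ-self k) ⟩
    1                            ∎
    where open ≡-Reasoning

  count-cong : {f g : Fin n → Bool} → (∀ i → f i ≡ g i) → count f ≡ count g
  count-cong {f = f} {g} f≗g = begin
    count f        ≡⟨ count≡sum f ⟩
    sum (𝟙 ∘ f)    ≡⟨ sum-cong-≗ (cong 𝟙 ∘ f≗g) ⟩
    sum (𝟙 ∘ g)    ≡⟨ count≡sum g ⟨
    count g        ∎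
    where open ≡-Reasoning

  count-false : count {n} (λ _ → false) ≡ 0
  count-false {n} = trans (count≡sum {n} (λ _ → false)) (sum-replicate-zero n)

  count-agree-off : {f g : Fin n → Bool} (k : Fin n) → (∀ i → i ≢ k → f i ≡ g i) →
    count f + 𝟙 (g k) ≡ count g + 𝟙 (f k)
  count-agree-off {f = f} {g} k f≡g = begin
    count f + 𝟙 (g k)        ≡⟨ cong (_+ 𝟙 (g k)) (count≡sum f) ⟩
    sum (𝟙 ∘ f) + 𝟙 (g k)    ≡⟨ sum-agree-off k (λ i i≢k → cong 𝟙 (f≡g i i≢k)) ⟩
    sum (𝟙 ∘ g) + 𝟙 (f k)    ≡⟨ cong (_+ 𝟙 (f k)) (count≡sum g) ⟨
    count g + 𝟙 (f k)        ∎
    where open ≡-Reasoning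

  count-≤-∧-not : (f g : Fin n → Bool) → count f ≤ count (λ i → f i ∧ not (g i)) + count g
  count-≤-∧-not f g = begin
    count f                                          ≡⟨ count≡sum f ⟩
    sum (𝟙 ∘ f)                                      ≤⟨ sum-mono-≤ (λ i → split (f i) (g i)) ⟩
    sum (λ i → 𝟙 (f i ∧ not (g i)) + 𝟙 (g i))        ≡⟨ ∑-distrib-+ (λ i → 𝟙 (f i ∧ not (g i))) (𝟙 ∘ g) ⟩
    sum (λ i → 𝟙 (f i ∧ not (g i))) + sum (𝟙 ∘ g)   ≡⟨ cong₂ _+_ (count≡sum (λ i → f i ∧ not (g i))) (count≡sum g) ⟨
    count (λ i → f i ∧ not (g i)) + count g          ∎
    where
    open ≤-Reasoning
    split : ∀ b c → 𝟙 b ≤ 𝟙 (b ∧ not c) + 𝟙 c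
    split true true = s≤s z≤n
    split true false = s≤s z≤n
    split false c = z≤n

  count+count-not : (f : Fin n → Bool) → count f + count (not ∘ f) ≡ n
  count+count-not {n} f = begin
    count f + count (not ∘ f)            ≡⟨ cong₂ _+_ (count≡sum f) (count≡sum (not ∘ f)) ⟩
    sum (𝟙 ∘ f) + sum (𝟙 ∘ not ∘ f)      ≡⟨ ∑-distrib-+ (𝟙 ∘ f) (𝟙 ∘ not ∘ f) ⟨
    sum (λ i → 𝟙 (f i) + 𝟙 (not (f i)))  ≡⟨ sum-cong-≗ (λ i → 𝟙+𝟙-not (f i)) ⟩
    sum {n} (λ _ → 1)                    ≡⟨ sum-ones n ⟩
    n                                    ∎
    where
    open ≡-Reasoning
    𝟙+𝟙-not : ∀ b → 𝟙 b + 𝟙 (not b) ≡ 1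
    𝟙+𝟙-not true = refl
    𝟙+𝟙-not false = refl
    sum-ones : ∀ m → sum {m} (λ _ → 1) ≡ m
    sum-ones zero = refl
    sum-ones (suc m) = cong suc (sum-ones m)

  sumOver : (Fin n → Bool) → (Fin n → ℕ) → ℕ
  sumOver c f = sum (λ i → 𝟙 (c i) * f i)

  sumOver-cong : {c : Fin n → Bool} {f g : Fin n → ℕ} → (∀ i → c i ≡ true → f i ≡ g i) →
    sumOver c f ≡ sumOver c g
  sumOver-cong {c = c} {f} {g} f≡g = sum-cong-≗ restricted
    where
    restricted : ∀ i → 𝟙 (c i) * f i ≡ 𝟙 (c i) * g i
    restricted i with c i in ci
    ... | true = cong (_+ 0) (f≡g i ci)
    ... | false = refl

module EdgeUpdate where
  open FinSum
  open import Data.Nat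
  open import Data.Nat.Properties
  open import Data.Bool using (Bool; true; false)
  open import Data.Fin.Properties using () renaming (_≟_ to _≟ᶠ_)
  open import Data.Sum using (_⊎_; inj₁; inj₂)
  open import Data.Vec.Functional using (updateAt)
  open import Data.Vec.Functional.Properties using (updateAt-updates; updateAt-minimal)
  open import Function using (_$_; const)
  open import Relation.Binary.PropositionalEquality
  open import Relation.Nullary using (yes; no)

  private variable
    n : ℕ

  setEdge : BipGraph n → Fin n → Fin n → Bool → BipGraph n
  setEdge H a b v = updateAt H a (λ row → updateAt row b (const v))

  module _ (H : BipGraph n) (a b : Fin n) (v : Bool) where

    setEdge-same : setEdge H a b v a b ≡ v
    setEdge-same = trans (cong (_$ b) (updateAt-updates a H)) (updateAt-updates b (H a))

    setEdge-other : ∀ x y → x ≢ a ⊎ y ≢ b → setEdge H a b v x y ≡ H x y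
    setEdge-other x y (inj₁ x≢a) = cong (_$ y) (updateAt-minimal x a H x≢a)
    setEdge-other x y (inj₂ y≢b) with x ≟ᶠ a
    ... | yes refl = trans (cong (_$ y) (updateAt-updates a H)) (updateAt-minimal y b (H a) y≢b)
    ... | no x≢a = setEdge-other x y (inj₁ x≢a)

    degA-setEdge-same : ∀ {w} → H a b ≡ w → degA (setEdge H a b v) a + 𝟙 w ≡ degA H a + 𝟙 v
    degA-setEdge-same refl = subst (λ u → degA (setEdge H a b v) a + 𝟙 (H a b) ≡ degA H a + 𝟙 u) setEdge-same
      (count-agree-off b (λ y y≢b → setEdge-other a y (inj₂ y≢b)))

    degB-setEdge-same : ∀ {w} → H a b ≡ w → degB (setEdge H a b v) b + 𝟙 w ≡ degB H b + 𝟙 v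
    degB-setEdge-same refl = subst (λ u → degB (setEdge H a b v) b + 𝟙 (H a b) ≡ degB H b + 𝟙 u) setEdge-same
      (count-agree-off a (λ x x≢a → setEdge-other x b (inj₁ x≢a)))

    degA-setEdge-other : ∀ x → x ≢ a → degA (setEdge H a b v) x ≡ degA H x
    degA-setEdge-other x x≢a = count-cong (λ y → setEdge-other x y (inj₁ x≢a))

    degB-setEdge-other : ∀ y → y ≢ b → degB (setEdge H a b v) y ≡ degB H y
    degB-setEdge-other y y≢b = count-cong (λ x → setEdge-other x y (inj₂ y≢b))

  _≗_+δ_ : (Fin n → ℕ) → (Fin n → ℕ) → Fin n → Set
  d′ ≗ d +δ a = ∀ x → d′ x ≡ d x + δ a x

  ≗+δ-intro : {d d′ : Fin n → ℕ} (a : Fin n) →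
    d′ a ≡ suc (d a) → (∀ x → x ≢ a → d′ x ≡ d x) → d′ ≗ d +δ a
  ≗+δ-intro {d = d} {d′} a d′a≡1+da d′≡d x with x ≟ᶠ a
  ... | yes refl = trans d′a≡1+da (+-comm 1 (d a))
  ... | no x≢a = trans (d′≡d x x≢a) (sym (+-identityʳ (d x)))

  ≗+δ-at : {d d′ : Fin n → ℕ} {a : Fin n} → d′ ≗ d +δ a → d′ a ≡ suc (d a)
  ≗+δ-at {d = d} {a = a} d′≗ = trans (d′≗ a) (trans (cong (d a +_) (δ-self a)) (+-comm (d a) 1))

  ≗+δ-off : {d d′ : Fin n → ℕ} {a x : Fin n} → d′ ≗ d +δ a → x ≢ a → d′ x ≡ d x
  ≗+δ-off {d = d} {x = x} d′≗ x≢a = trans (d′≗ x) (trans (cong (d x +_) (δ-other x≢a)) (+-identityʳ (d x)))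

  ≗+δ-≤ : {d d′ c : Fin n → ℕ} {a : Fin n} →
    d′ ≗ d +δ a → d a < c a → (∀ x → d x ≤ c x) → ∀ x → d′ x ≤ c x
  ≗+δ-≤ {a = a} d′≗ da<ca d≤c x with x ≟ᶠ a
  ... | yes refl = ≤-trans (≤-reflexive (≗+δ-at d′≗)) da<ca
  ... | no x≢a = ≤-trans (≤-reflexive (≗+δ-off d′≗ x≢a)) (d≤c x)

  ≗+δ-sum : {d d′ : Fin n → ℕ} {a : Fin n} → d′ ≗ d +δ a → sum d′ ≡ suc (sum d)
  ≗+δ-sum {d = d} {d′} {a} d′≗ = begin
    sum d′                        ≡⟨ sum-cong-≗ d′≗ ⟩
    sum (λ x → d x + δ a x)       ≡⟨ ∑-distrib-+ d (δ a) ⟩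
    sum d + sum (δ a)             ≡⟨ cong (sum d +_) (sum-δ a) ⟩
    sum d + 1                     ≡⟨ +-comm (sum d) 1 ⟩
    suc (sum d)                   ∎
    where open ≡-Reasoning

  ≗+δ-injective : {d₁ d₂ d₃ : Fin n → ℕ} {q : Fin n} →
    d₂ ≗ d₁ +δ q → d₂ ≗ d₃ +δ q → ∀ x → d₃ x ≡ d₁ x
  ≗+δ-injective {q = q} d₂≗d₁ d₂≗d₃ x = +-cancelʳ-≡ (δ q x) _ _ (trans (sym (d₂≗d₃ x)) (d₂≗d₁ x))

  ≗+δ-exchange : {d₀ d₁ d₂ d₃ : Fin n → ℕ} {p q : Fin n} →
    d₁ ≗ d₀ +δ p → d₂ ≗ d₁ +δ q → d₂ ≗ d₃ +δ p → d₃ ≗ d₀ +δ q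
  ≗+δ-exchange {d₀ = d₀} {d₁} {d₂} {d₃} {p} {q} d₁≗ d₂≗ d₂≗d₃ x = +-cancelʳ-≡ (δ p x) _ _ (begin
    d₃ x + δ p x            ≡⟨ d₂≗d₃ x ⟨
    d₂ x                    ≡⟨ d₂≗ x ⟩
    d₁ x + δ q x            ≡⟨ cong (_+ δ q x) (d₁≗ x) ⟩
    d₀ x + δ p x + δ q x    ≡⟨ +-assoc (d₀ x) (δ p x) (δ q x) ⟩
    d₀ x + (δ p x + δ q x)  ≡⟨ cong (d₀ x +_) (+-comm (δ p x) (δ q x)) ⟩
    d₀ x + (δ q x + δ p x)  ≡⟨ +-assoc (d₀ x) (δ q x) (δ p x) ⟨
    d₀ x + δ q x + δ p x    ∎)
    where open ≡-Reasoning

  private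
    m+0≡n+1⇒m≡1+n : ∀ {m n} → m + 0 ≡ n + 1 → m ≡ suc n
    m+0≡n+1⇒m≡1+n {m} {n} eq = trans (sym (+-identityʳ m)) (trans eq (+-comm n 1))

  module _ {H : BipGraph n} {a b : Fin n} where

    degA-addEdge : H a b ≡ false → degA (setEdge H a b true) ≗ degA H +δ a
    degA-addEdge Hab≡false = ≗+δ-intro a
      (m+0≡n+1⇒m≡1+n (degA-setEdge-same H a b true Hab≡false))
      (degA-setEdge-other H a b true)

    degB-addEdge : H a b ≡ false → degB (setEdge H a b true) ≗ degB H +δ b
    degB-addEdge Hab≡false = ≗+δ-intro b
      (m+0≡n+1⇒m≡1+n (degB-setEdge-same H a b true Hab≡false))
      (degB-setEdge-other H a b true)

    degA-removeEdge : H a b ≡ true → degA H ≗ degA (setEdge H a b false) +δ a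
    degA-removeEdge Hab≡true = ≗+δ-intro a
      (m+0≡n+1⇒m≡1+n (sym (degA-setEdge-same H a b false Hab≡true)))
      (λ x x≢a → sym (degA-setEdge-other H a b false x x≢a))

    degB-removeEdge : H a b ≡ true → degB H ≗ degB (setEdge H a b false) +δ b
    degB-removeEdge Hab≡true = ≗+δ-intro b
      (m+0≡n+1⇒m≡1+n (sym (degB-setEdge-same H a b false Hab≡true)))
      (λ y y≢b → sym (degB-setEdge-other H a b false y y≢b))

    setEdge-subgraph : {G : BipGraph n} {v : Bool} → SubgraphOf H G → (v ≡ true → G a b ≡ true) →
      SubgraphOf (setEdge H a b v) G
    setEdge-subgraph {v = v} H⊆G Gab x y H′xy with x ≟ᶠ a | y ≟ᶠ b
    ... | yes refl | yes refl = Gab (trans (sym (setEdge-same H a b v)) H′xy)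
    ... | no x≢a | _ = H⊆G x y (trans (sym (setEdge-other H a b v x y (inj₁ x≢a))) H′xy)
    ... | _ | no y≢b = H⊆G x y (trans (sym (setEdge-other H a b v x y (inj₂ y≢b))) H′xy)

  sum-degA≡sum-degB : (H : BipGraph n) → sum (degA H) ≡ sum (degB H)
  sum-degA≡sum-degB H = begin
    sum (degA H)                                ≡⟨ sum-cong-≗ (λ a → count≡sum (H a)) ⟩
    sum (λ a → sum (λ b → 𝟙 (H a b)))           ≡⟨ ∑-comm (λ a b → 𝟙 (H a b)) ⟩
    sum (λ b → sum (λ a → 𝟙 (H a b)))           ≡⟨ sum-cong-≗ (λ b → count≡sum (λ a → H a b)) ⟨
    sum (degB H)                                ∎
    where open ≡-Reasoning

module Augmentation {n : ℕ} (G : BipGraph n) (nA nB : Fin n → ℕ) where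
  open FinSum
  open EdgeUpdate
  open import Data.Nat
  open import Data.Nat.Properties
  open import Data.Bool using (Bool; true; false; not; _∧_)
  import Data.Bool as Bool
  open import Data.Fin.Properties using (any?)
  open import Data.Product using (Σ; _×_; _,_; proj₁; proj₂)
  open import Data.Empty using (⊥)
  open import Function using (_∘_)
  open import Data.Sum using (inj₁; inj₂)
  open import Relation.Binary.PropositionalEquality
  open import Relation.Nullary using (¬_; yes; no; contradiction)
  open import Relation.Nullary.Decidable using (_×-dec_)

  record Feasible (H : BipGraph n) : Set where
    field
      subgraph : SubgraphOf H G
      degA≤ : ∀ a → degA H a ≤ nA a
      degB≤ : ∀ b → degB H b ≤ nB b

  edges : BipGraph n → ℕ
  edges H = sum (degA H)

  unused : BipGraph n → Fin n → Fin n → Bool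
  unused H x y = G x y ∧ not (H x y)

  unused⇒G∧¬H : ∀ H {x y} → unused H x y ≡ true → G x y ≡ true × H x y ≡ false
  unused⇒G∧¬H H {x} {y} u with G x y | H x y
  ... | true | false = refl , refl
  ... | true | true = contradiction u λ ()
  ... | false | _ = contradiction u λ ()

  record Stuck (H : BipGraph n) (a b : Fin n) : Set where
    field
      saturated : ∀ y → unused H a y ≡ true → degB H y ≡ nB y
      no-alternating-path : ∀ x y → unused H a y ≡ true → H x y ≡ true → unused H x b ≡ true → ⊥

  Augmentable : BipGraph n → Set
  Augmentable H = Σ (BipGraph n) λ H′ → Feasible H′ × edges H′ ≡ suc (edges H)

  module _ {H : BipGraph n} (F : Feasible H) where
    open Feasible F

    augmentable : ∀ {H′ a b} → degA H a < nA a → degB H b < nB b → SubgraphOf H′ G →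
      degA H′ ≗ degA H +δ a → degB H′ ≗ degB H +δ b → Augmentable H
    augmentable a-deficient b-deficient H′⊆G degA′ degB′ =
      _ , record { subgraph = H′⊆G
                 ; degA≤ = ≗+δ-≤ degA′ a-deficient degA≤
                 ; degB≤ = ≗+δ-≤ degB′ b-deficient degB≤
                 }
        , ≗+δ-sum degA′

    augment-by-edge : ∀ {a y} → degA H a < nA a → unused H a y ≡ true → degB H y < nB y → Augmentable H
    augment-by-edge {a} {y} a-deficient ay-unused y-deficient =
      augmentable {H′ = setEdge H a y true} a-deficient y-deficient
        (setEdge-subgraph subgraph (λ _ → Gay)) (degA-addEdge Hay≡false) (degB-addEdge Hay≡false)
      where
      Gay : G a y ≡ true
      Gay = proj₁ (unused⇒G∧¬H H ay-unused)
      Hay≡false : H a y ≡ false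
      Hay≡false = proj₂ (unused⇒G∧¬H H ay-unused)

    augment-by-switch : ∀ {a b x y} → degA H a < nA a → degB H b < nB b →
      unused H a y ≡ true → H x y ≡ true → unused H x b ≡ true → Augmentable H
    augment-by-switch {a} {b} {x} {y} a-deficient b-deficient ay-unused Hxy≡true xb-unused =
      augmentable {H′ = H₃} a-deficient b-deficient H₃⊆G degA-H₃ degB-H₃
      where
      Gay : G a y ≡ true
      Gay = proj₁ (unused⇒G∧¬H H ay-unused)
      Hay≡false : H a y ≡ false
      Hay≡false = proj₂ (unused⇒G∧¬H H ay-unused)
      Gxb : G x b ≡ true
      Gxb = proj₁ (unused⇒G∧¬H H xb-unused)
      Hxb≡false : H x b ≡ false
      Hxb≡false = proj₂ (unused⇒G∧¬H H xb-unused)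
      x≢a : x ≢ a
      x≢a refl = contradiction (trans (sym Hxy≡true) Hay≡false) λ ()
      y≢b : y ≢ b
      y≢b refl = contradiction (trans (sym Hxy≡true) Hxb≡false) λ ()

      H₁ H₂ H₃ : BipGraph n
      H₁ = setEdge H a y true
      H₂ = setEdge H₁ x b true
      H₃ = setEdge H₂ x y false

      H₁xb≡false : H₁ x b ≡ false
      H₁xb≡false = trans (setEdge-other H a y true x b (inj₁ x≢a)) Hxb≡false
      H₂xy≡true : H₂ x y ≡ true
      H₂xy≡true = trans (setEdge-other H₁ x b true x y (inj₂ y≢b))
                    (trans (setEdge-other H a y true x y (inj₁ x≢a)) Hxy≡true)

      H₃⊆G : SubgraphOf H₃ G
      H₃⊆G = setEdge-subgraph (setEdge-subgraph (setEdge-subgraph subgraph (λ _ → Gay)) (λ _ → Gxb)) (λ ())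

      degA-H₃ : degA H₃ ≗ degA H +δ a
      degA-H₃ z = trans
        (≗+δ-injective (degA-addEdge {H = H₁} H₁xb≡false) (degA-removeEdge {H = H₂} H₂xy≡true) z)
        (degA-addEdge {H = H} Hay≡false z)
      degB-H₃ : degB H₃ ≗ degB H +δ b
      degB-H₃ = ≗+δ-exchange (degB-addEdge {H = H} Hay≡false) (degB-addEdge {H = H₁} H₁xb≡false)
                  (degB-removeEdge {H = H₂} H₂xy≡true)

    augment : ∀ {a b} → degA H a < nA a → degB H b < nB b → ¬ Stuck H a b → Augmentable H
    augment {a} {b} a-deficient b-deficient not-stuck
      with any? (λ y → (unused H a y Bool.≟ true) ×-dec (degB H y <? nB y))
    ... | yes (y , ay-unused , y-deficient) = augment-by-edge a-deficient ay-unused y-deficient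
    ... | no no-deficient-neighbour
      with any? (λ x → any? (λ y →
             (unused H a y Bool.≟ true) ×-dec (H x y Bool.≟ true) ×-dec (unused H x b Bool.≟ true)))
    ... | yes (x , y , ay-unused , Hxy≡true , xb-unused) =
      augment-by-switch a-deficient b-deficient ay-unused Hxy≡true xb-unused
    ... | no no-path = contradiction stuck not-stuck
      where
      stuck : Stuck H a b
      stuck = record
        { saturated = λ y ay-unused →
            ≤-antisym (degB≤ y) (≮⇒≥ λ y-deficient → no-deficient-neighbour (y , ay-unused , y-deficient))
        ; no-alternating-path = λ x y ay-unused Hxy≡true xb-unused →
            no-path (x , y , ay-unused , Hxy≡true , xb-unused)
        }

  NeverStuck : Set
  NeverStuck = ∀ {H a b} → Feasible H → degA H a < nA a → degB H b < nB b → ¬ Stuck H a b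

  Factor : Set
  Factor = Σ (BipGraph n) λ H → SubgraphOf H G × ((∀ a → degA H a ≡ nA a) × (∀ b → degB H b ≡ nB b))

  module _ (balanced : sum nA ≡ sum nB) where

    sum-degB≡sum-nB : ∀ {H} → edges H ≡ sum nA → sum (degB H) ≡ sum nB
    sum-degB≡sum-nB {H} e = trans (sym (sum-degA≡sum-degB H)) (trans e balanced)

    sum-degB<sum-nB : ∀ {H} → edges H < sum nA → sum (degB H) < sum nB
    sum-degB<sum-nB {H} lt = subst₂ _<_ (sum-degA≡sum-degB H) balanced lt

    module _ (never-stuck : NeverStuck) where

      extend : ∀ k {H} → Feasible H → edges H + k ≡ sum nA → Factor
      extend zero {H} F e =
        H , subgraph , sum-≡⇒≗ degA≤ edges≡ , sum-≡⇒≗ degB≤ (sum-degB≡sum-nB edges≡)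
        where
        open Feasible F
        edges≡ : edges H ≡ sum nA
        edges≡ = trans (sym (+-identityʳ (edges H))) e
      extend (suc k) {H} F e =
        let a , a-deficient = sum-<⇒∃< {f = degA H} {nA} edges<
            b , b-deficient = sum-<⇒∃< {f = degB H} {nB} (sum-degB<sum-nB edges<)
            H′ , F′ , edges′ = augment F a-deficient b-deficient (never-stuck F a-deficient b-deficient)
        in extend k F′ (trans (cong (_+ k) edges′) (trans (sym (+-suc (edges H) k)) e))
        where
        edges< : edges H < sum nA
        edges< = subst (edges H <_) e (m<m+n (edges H) z<s)

      factor : Factor
      factor = extend (sum nA) empty-feasible (cong (_+ sum nA) no-edges)
        where
        empty : BipGraph n
        empty _ _ = false
        empty-feasible : Feasible empty
        empty-feasible = record
          { subgraph = λ _ _ ()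
          ; degA≤ = λ a → subst (_≤ nA a) (sym (count-false {n})) z≤n
          ; degB≤ = λ b → subst (_≤ nB b) (sym (count-false {n})) z≤n
          }
        no-edges : edges empty ≡ 0
        no-edges = trans (sum-cong-≗ {n} (λ _ → count-false {n})) (sum-replicate-zero n)

  module _ {H : BipGraph n} (F : Feasible H) where
    open Feasible F

    degA-G≤unused+nA : ∀ a → degA G a ≤ count (unused H a) + nA a
    degA-G≤unused+nA a = ≤-trans (count-≤-∧-not (G a) (H a)) (+-monoʳ-≤ (count (unused H a)) (degA≤ a))

    degB-G≤unused+nB : ∀ b → degB G b ≤ count (λ x → unused H x b) + nB b
    degB-G≤unused+nB b =
      ≤-trans (count-≤-∧-not (λ x → G x b) (λ x → H x b)) (+-monoʳ-≤ (count (λ x → unused H x b)) (degB≤ b))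

    stuck-sumOver-≤ : ∀ {a b} → Stuck H a b → sumOver (unused H a) nB ≤ sumOver (λ x → not (unused H x b)) nA
    stuck-sumOver-≤ {a} {b} stuck = begin
      sumOver N nB                                  ≡⟨ sumOver-cong saturated ⟨
      sumOver N (degB H)                            ≡⟨ sum-cong-≗ (λ y → cong (𝟙 (N y) *_) (count≡sum (λ x → H x y))) ⟩
      sum (λ y → 𝟙 (N y) * sum (λ x → 𝟙 (H x y)))  ≡⟨ sum-cong-≗ (λ y → *-distribˡ-sum (𝟙 (N y)) (λ x → 𝟙 (H x y))) ⟩
      sum (λ y → sum (λ x → N∧H x y))              ≡⟨ ∑-comm (λ y x → N∧H x y) ⟩
      sum (λ x → sum (λ y → N∧H x y))              ≤⟨ sum-mono-≤ row-bound ⟩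
      sumOver (not ∘ M) (degA H)                    ≤⟨ sum-mono-≤ (λ x → *-monoʳ-≤ (𝟙 (not (M x))) (degA≤ x)) ⟩
      sumOver (not ∘ M) nA                          ∎
      where
      open ≤-Reasoning
      open Stuck stuck
      N M : Fin n → Bool
      N = unused H a
      M x = unused H x b
      N∧H : Fin n → Fin n → ℕ
      N∧H x y = 𝟙 (N y) * 𝟙 (H x y)
      row-bound : ∀ x → sum (N∧H x) ≤ 𝟙 (not (M x)) * degA H x
      row-bound x with M x in xb-unused
      ... | true = ≤-reflexive (trans (sum-cong-≗ no-edge) (sum-replicate-zero n))
        where
        no-edge : ∀ y → N∧H x y ≡ 0
        no-edge y with N y in ay-unused | H x y in Hxy
        ... | true | true = contradiction xb-unused (no-alternating-path x y ay-unused Hxy)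
        ... | true | false = refl
        ... | false | _ = refl
      ... | false = begin
        sum (N∧H x)          ≤⟨ sum-mono-≤ (λ y → 𝟙*-≤ (N y) (𝟙 (H x y))) ⟩
        sum (𝟙 ∘ H x)        ≡⟨ count≡sum (H x) ⟨
        degA H x             ≡⟨ +-identityʳ (degA H x) ⟨
        1 * degA H x         ∎

module RationalBounds where
  open FinSum using (𝟙; sum; count≡sum; sumOver)
  open import Data.Nat as ℕ using (zero; suc)
  import Data.Nat.Properties as ℕ
  open import Data.Integer as ℤ using (+_)
  import Data.Integer.Properties as ℤ
  open import Data.Rational
  open import Data.Rational.Properties
  import Data.Nat.Coprimality as Coprimality
  open import Data.Bool using (Bool; true; false)
  open import Data.Fin using (zero; suc)
  open import Data.Empty using (⊥)
  open import Function using (_∘_)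
  open import Relation.Binary.PropositionalEquality
  open import Data.Rational.Solver using (module +-*-Solver)
  open +-*-Solver using (solve; _:+_; _:-_; _:*_; _:=_; con)

  ℕ→ℚ≡mkℚ : ∀ m → ℕ→ℚ m ≡ mkℚ (+ m) 0 (Coprimality.sym (Coprimality.1-coprimeTo m))
  ℕ→ℚ≡mkℚ m = normalize-coprime (Coprimality.sym (Coprimality.1-coprimeTo m))

  ℕ→ℚ-+ : ∀ m k → ℕ→ℚ (m ℕ.+ k) ≡ ℕ→ℚ m + ℕ→ℚ k
  ℕ→ℚ-+ m k = trans (/-cong (cong₂ ℤ._+_ (sym (ℤ.*-identityʳ (+ m))) (sym (ℤ.*-identityʳ (+ k)))) refl)
    (sym (cong₂ _+_ (ℕ→ℚ≡mkℚ m) (ℕ→ℚ≡mkℚ k)))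

  ℕ→ℚ-mono-≤ : ∀ {m k} → m ℕ.≤ k → ℕ→ℚ m ≤ ℕ→ℚ k
  ℕ→ℚ-mono-≤ {m} {k} m≤k rewrite ℕ→ℚ≡mkℚ m | ℕ→ℚ≡mkℚ k =
    *≤* (subst₂ ℤ._≤_ (sym (ℤ.*-identityʳ (+ m))) (sym (ℤ.*-identityʳ (+ k))) (ℤ.+≤+ m≤k))

  ℕ→ℚ-mono-< : ∀ {m k} → m ℕ.< k → ℕ→ℚ m < ℕ→ℚ k
  ℕ→ℚ-mono-< {m} {k} m<k rewrite ℕ→ℚ≡mkℚ m | ℕ→ℚ≡mkℚ k =
    *<* (subst₂ ℤ._<_ (sym (ℤ.*-identityʳ (+ m))) (sym (ℤ.*-identityʳ (+ k))) (ℤ.+<+ m<k))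

  ℕ→ℚ-suc-* : ∀ s L → ℕ→ℚ (suc s) * L ≡ L + ℕ→ℚ s * L
  ℕ→ℚ-suc-* s L = begin
    ℕ→ℚ (suc s) * L          ≡⟨ cong (_* L) (ℕ→ℚ-+ 1 s) ⟩
    (1ℚ + ℕ→ℚ s) * L         ≡⟨ *-distribʳ-+ L 1ℚ (ℕ→ℚ s) ⟩
    1ℚ * L + ℕ→ℚ s * L       ≡⟨ cong (_+ ℕ→ℚ s * L) (*-identityˡ L) ⟩
    L + ℕ→ℚ s * L            ∎
    where open ≡-Reasoning

  private
    ℕ→ℚ-1*-+ : ∀ m s → ℕ→ℚ (1 ℕ.* m ℕ.+ s) ≡ ℕ→ℚ m + ℕ→ℚ s
    ℕ→ℚ-1*-+ m s = trans (ℕ→ℚ-+ (1 ℕ.* m) s) (cong (λ k → ℕ→ℚ k + ℕ→ℚ s) (ℕ.*-identityˡ m))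

  module _ {n : ℕ} (c : Fin n → Bool) (f : Fin n → ℕ) where

    count*≤sumOver : ∀ {L} → (∀ i → c i ≡ true → L ≤ ℕ→ℚ (f i)) →
      ℕ→ℚ (count c) * L ≤ ℕ→ℚ (sumOver c f)
    count*≤sumOver {L} L≤f = subst (λ k → ℕ→ℚ k * L ≤ ℕ→ℚ (sumOver c f)) (sym (count≡sum c)) (go c f L≤f)
      where
      go : ∀ {m} (c : Fin m → Bool) (f : Fin m → ℕ) → (∀ i → c i ≡ true → L ≤ ℕ→ℚ (f i)) →
        ℕ→ℚ (sum (𝟙 ∘ c)) * L ≤ ℕ→ℚ (sumOver c f)
      go {zero} c f L≤f = ≤-reflexive (*-zeroˡ L)
      go {suc m} c f L≤f with c zero in c₀
      ... | true = begin
        ℕ→ℚ (suc (sum (𝟙 ∘ c ∘ suc))) * L              ≡⟨ ℕ→ℚ-suc-* (sum (𝟙 ∘ c ∘ suc)) L ⟩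
        L + ℕ→ℚ (sum (𝟙 ∘ c ∘ suc)) * L                ≤⟨ +-mono-≤ (L≤f zero c₀) (go (c ∘ suc) (f ∘ suc) (L≤f ∘ suc)) ⟩
        ℕ→ℚ (f zero) + ℕ→ℚ (sumOver (c ∘ suc) (f ∘ suc)) ≡⟨ ℕ→ℚ-1*-+ (f zero) (sumOver (c ∘ suc) (f ∘ suc)) ⟨
        ℕ→ℚ (1 ℕ.* f zero ℕ.+ sumOver (c ∘ suc) (f ∘ suc)) ∎
        where open ≤-Reasoning
      ... | false = go (c ∘ suc) (f ∘ suc) (L≤f ∘ suc)

    sumOver≤count* : ∀ {U} → (∀ i → c i ≡ true → ℕ→ℚ (f i) ≤ U) →
      ℕ→ℚ (sumOver c f) ≤ ℕ→ℚ (count c) * U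
    sumOver≤count* {U} f≤U = subst (λ k → ℕ→ℚ (sumOver c f) ≤ ℕ→ℚ k * U) (sym (count≡sum c)) (go c f f≤U)
      where
      go : ∀ {m} (c : Fin m → Bool) (f : Fin m → ℕ) → (∀ i → c i ≡ true → ℕ→ℚ (f i) ≤ U) →
        ℕ→ℚ (sumOver c f) ≤ ℕ→ℚ (sum (𝟙 ∘ c)) * U
      go {zero} c f f≤U = ≤-reflexive (sym (*-zeroˡ U))
      go {suc m} c f f≤U with c zero in c₀
      ... | true = begin
        ℕ→ℚ (1 ℕ.* f zero ℕ.+ sumOver (c ∘ suc) (f ∘ suc)) ≡⟨ ℕ→ℚ-1*-+ (f zero) (sumOver (c ∘ suc) (f ∘ suc)) ⟩
        ℕ→ℚ (f zero) + ℕ→ℚ (sumOver (c ∘ suc) (f ∘ suc)) ≤⟨ +-mono-≤ (f≤U zero c₀) (go (c ∘ suc) (f ∘ suc) (f≤U ∘ suc)) ⟩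
        U + ℕ→ℚ (sum (𝟙 ∘ c ∘ suc)) * U                ≡⟨ ℕ→ℚ-suc-* (sum (𝟙 ∘ c ∘ suc)) U ⟨
        ℕ→ℚ (suc (sum (𝟙 ∘ c ∘ suc))) * U              ∎
        where open ≤-Reasoning
      ... | false = go (c ∘ suc) (f ∘ suc) (f≤U ∘ suc)

  0≤q-p : ∀ {p q} → p ≤ q → 0ℚ ≤ q - p
  0≤q-p {p} {q} p≤q = subst (_≤ q - p) (+-inverseʳ p) (+-monoˡ-≤ (- p) p≤q)

  0≤p*q : ∀ {p q} → 0ℚ ≤ p → 0ℚ ≤ q → 0ℚ ≤ p * q
  0≤p*q {p} {q} 0≤p 0≤q =
    nonNegative⁻¹ (p * q) {{nonNeg*nonNeg⇒nonNeg p {{nonNegative 0≤p}} q {{nonNegative 0≤q}}}}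

  0<p*q : ∀ {p q} → 0ℚ < p → 0ℚ < q → 0ℚ < p * q
  0<p*q {p} {q} 0<p 0<q = positive⁻¹ (p * q) {{pos*pos⇒pos p {{positive 0<p}} q {{positive 0<q}}}}

  stuck-bounds-absurd : ∀ {ξ α ν k m m̄} →
    0ℚ < ξ → ξ ≤ 1ℚ → 0ℚ < α → α ≤ ξ * ξ → 0ℚ < ν → m + m̄ ≡ ν →
    (½ + (+ 4 / 1) * ξ) * ν ≤ k + (ξ + α) * ν →
    (½ + (+ 4 / 1) * ξ) * ν ≤ m + (ξ + α) * ν →
    k * ((ξ - α) * ν) ≤ m̄ * ((ξ + α) * ν) → ⊥
  stuck-bounds-absurd {ξ} {α} {ν} {k} {m} {m̄} 0<ξ ξ≤1 0<α α≤ξ² 0<ν m+m̄≡ν δ≤k+U δ≤m+U kL≤m̄U =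
    <-irrefl (sym weighted-sum≡0) 0<weighted-sum
    where
    δ U L P : ℚ
    δ = (½ + (+ 4 / 1) * ξ) * ν
    U = (ξ + α) * ν
    L = (ξ - α) * ν
    P = (+ 6 / 1) * ξ * ξ - (+ 2 / 1) * ξ * α - α

    0≤ξ-α : 0ℚ ≤ ξ - α
    0≤ξ-α = 0≤q-p (≤-trans α≤ξ² ξ²≤ξ)
      where
      ξ²≤ξ : ξ * ξ ≤ ξ
      ξ²≤ξ = subst (ξ * ξ ≤_) (*-identityʳ ξ) (*-monoˡ-≤-nonNeg ξ {{pos⇒nonNeg ξ {{positive 0<ξ}}}} ξ≤1)

    P≡ : P ≡ (+ 3 / 1) * (ξ * ξ) + (ξ * ξ - α) + (+ 2 / 1) * ξ * (ξ - α)
    P≡ = solve 2 (λ ξ α → con (+ 6 / 1) :* ξ :* ξ :- con (+ 2 / 1) :* ξ :* α :- α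
       := con (+ 3 / 1) :* (ξ :* ξ) :+ (ξ :* ξ :- α) :+ con (+ 2 / 1) :* ξ :* (ξ :- α)) refl ξ α

    0<P : 0ℚ < P
    0<P = subst (0ℚ <_) (sym P≡)
      (+-mono-<-≤ (+-mono-<-≤ (0<p*q (positive⁻¹ (+ 3 / 1)) (0<p*q 0<ξ 0<ξ)) (0≤q-p α≤ξ²))
                                              (0≤p*q (0≤p*q (nonNegative⁻¹ (+ 2 / 1)) (<⇒≤ 0<ξ)) 0≤ξ-α))

    -- Nonnegative multiples of the three hypotheses plus ν²P > 0 add up to (m + m̄ − ν)U = 0.
    weighted-sum : ℚ
    weighted-sum = (k + U - δ) * L + (m + U - δ) * U + (m̄ * U - k * L) + ν * ν * P

    weighted-sum≡0 : weighted-sum ≡ 0ℚ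
    weighted-sum≡0 = begin
      weighted-sum          ≡⟨ solve 6 (λ ξ α ν k m m̄ →
        (k :+ (ξ :+ α) :* ν :- (con ½ :+ con (+ 4 / 1) :* ξ) :* ν) :* ((ξ :- α) :* ν)
        :+ (m :+ (ξ :+ α) :* ν :- (con ½ :+ con (+ 4 / 1) :* ξ) :* ν) :* ((ξ :+ α) :* ν)
        :+ (m̄ :* ((ξ :+ α) :* ν) :- k :* ((ξ :- α) :* ν))
        :+ ν :* ν :* (con (+ 6 / 1) :* ξ :* ξ :- con (+ 2 / 1) :* ξ :* α :- α)
        := (m :+ m̄ :- ν) :* ((ξ :+ α) :* ν)) refl ξ α ν k m m̄ ⟩
      (m + m̄ - ν) * U      ≡⟨ cong (λ s → (s - ν) * U) m+m̄≡ν ⟩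
      (ν - ν) * U          ≡⟨ cong (_* U) (+-inverseʳ ν) ⟩
      0ℚ * U               ≡⟨ *-zeroˡ U ⟩
      0ℚ                   ∎
      where open ≡-Reasoning

    0<weighted-sum : 0ℚ < weighted-sum
    0<weighted-sum = subst (_< weighted-sum) (+-identityˡ 0ℚ)
      (+-mono-≤-< (+-mono-≤ (+-mono-≤ (0≤p*q (0≤q-p δ≤k+U) (0≤p*q 0≤ξ-α (<⇒≤ 0<ν)))
                                      (0≤p*q (0≤q-p δ≤m+U) (0≤p*q (<⇒≤ (+-mono-< 0<ξ 0<α)) (<⇒≤ 0<ν))))
                            (0≤q-p kL≤m̄U))
                  (0<p*q (0<p*q 0<ν 0<ν) 0<P))

open import Data.Product using (Σ; _×_; _,_; proj₁; proj₂)
open import Data.Integer using (+_)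
open import Data.Rational using (ℚ; _≤_; _<_; _+_; _-_; _*_; _/_; 0ℚ; 1ℚ; ½)
open import Data.Rational.Properties using (≤-trans; +-monoʳ-≤; ≤-reflexive; positive⁻¹)
import Data.Nat as ℕ
import Data.Nat.Properties as ℕ
open import Data.Bool using (Bool; not)
open import Data.Fin.Properties using (toℕ<n)
open import Function using (_∘_)
open import Relation.Binary.PropositionalEquality using (_≡_; sym; trans; cong)
open FinSum using (sumFin≡sum; count+count-not)
open RationalBounds
open Augmentation using (NeverStuck; unused; factor; degA-G≤unused+nA; degB-G≤unused+nB; stuck-sumOver-≤)

never-stuck : ∀ {ξ α : ℚ} {n} (G : BipGraph n) (nA nB : Fin n → ℕ) →
  0ℚ < ξ → ξ ≤ 1ℚ → 0ℚ < α → α ≤ ξ * ξ →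
  MinDegAtLeast G ((½ + (+ 4 / 1) * ξ) * ℕ→ℚ n) →
  (∀ a → ((ξ - α) * ℕ→ℚ n ≤ ℕ→ℚ (nA a)) × (ℕ→ℚ (nA a) ≤ (ξ + α) * ℕ→ℚ n)) →
  (∀ b → ((ξ - α) * ℕ→ℚ n ≤ ℕ→ℚ (nB b)) × (ℕ→ℚ (nB b) ≤ (ξ + α) * ℕ→ℚ n)) →
  NeverStuck G nA nB
never-stuck {ξ} {α} {n} G nA nB 0<ξ ξ≤1 0<α α≤ξ² (minDegA , minDegB) nA-bounds nB-bounds
            {H} {a} {b} F _ _ stuck =
  stuck-bounds-absurd {k = ℕ→ℚ (count N)} {ℕ→ℚ (count M)} {ℕ→ℚ (count (not ∘ M))}
    0<ξ ξ≤1 0<α α≤ξ² 0<ν m+m̄≡ν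
    (lower-degree (count N) (minDegA a) (degA-G≤unused+nA G nA nB F a) (proj₂ (nA-bounds a)))
    (lower-degree (count M) (minDegB b) (degB-G≤unused+nB G nA nB F b) (proj₂ (nB-bounds b)))
    kL≤m̄U
  where
  N M : Fin n → Bool
  N = unused G nA nB H a
  M x = unused G nA nB H x b
  ν U : ℚ
  ν = ℕ→ℚ n
  U = (ξ + α) * ν

  0<ν : 0ℚ < ν
  0<ν = ℕ→ℚ-mono-< (ℕ.≤-<-trans ℕ.z≤n (toℕ<n a))

  m+m̄≡ν : ℕ→ℚ (count M) + ℕ→ℚ (count (not ∘ M)) ≡ ν
  m+m̄≡ν = trans (sym (ℕ→ℚ-+ (count M) (count (not ∘ M)))) (cong ℕ→ℚ (count+count-not M))

  lower-degree : ∀ {δ d t} c → δ ≤ ℕ→ℚ d → d ℕ.≤ c ℕ.+ t → ℕ→ℚ t ≤ U → δ ≤ ℕ→ℚ c + U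
  lower-degree {t = t} c δ≤d d≤c+t t≤U =
    ≤-trans δ≤d (≤-trans (ℕ→ℚ-mono-≤ d≤c+t)
                (≤-trans (≤-reflexive (ℕ→ℚ-+ c t)) (+-monoʳ-≤ (ℕ→ℚ c) t≤U)))

  kL≤m̄U : ℕ→ℚ (count N) * ((ξ - α) * ν) ≤ ℕ→ℚ (count (not ∘ M)) * U
  kL≤m̄U = ≤-trans (count*≤sumOver N nB (λ y _ → proj₁ (nB-bounds y)))
           (≤-trans (ℕ→ℚ-mono-≤ (stuck-sumOver-≤ G nA nB F stuck))
                    (sumOver≤count* (not ∘ M) nA (λ x _ → proj₂ (nA-bounds x))))

proposition8p10 :
    Σ ℚ λ ξ₀ → 0ℚ < ξ₀ ×
    ((ξ : ℚ) → 0ℚ < ξ → ξ ≤ ξ₀ →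
      Σ ℚ λ α₀ → 0ℚ < α₀ ×
      ((α : ℚ) → 0ℚ < α → α ≤ α₀ →
        Σ ℕ λ n₀ →
        ((n : ℕ) → Data.Nat._≤_ n₀ n →
          (G : BipGraph n) →
          MinDegAtLeast G ((½ + (+ 4 / 1) * ξ) * ℕ→ℚ n) →
          (nA nB : Fin n → ℕ) →
          (∀ a → ((ξ - α) * ℕ→ℚ n ≤ ℕ→ℚ (nA a)) × (ℕ→ℚ (nA a) ≤ (ξ + α) * ℕ→ℚ n)) →
          (∀ b → ((ξ - α) * ℕ→ℚ n ≤ ℕ→ℚ (nB b)) × (ℕ→ℚ (nB b) ≤ (ξ + α) * ℕ→ℚ n)) →
          sumFin nA ≡ sumFin nB →
          Σ (BipGraph n) λ G' → SubgraphOf G' G ×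
            ((∀ a → degA G' a ≡ nA a) × (∀ b → degB G' b ≡ nB b)))))
proposition8p10 =
  1ℚ , positive⁻¹ 1ℚ , λ ξ 0<ξ ξ≤1 →
  ξ * ξ , 0<p*q 0<ξ 0<ξ , λ α 0<α α≤ξ² →
  0 , λ n _ G minDeg nA nB nA-bounds nB-bounds balanced →
  factor G nA nB (trans (sym (sumFin≡sum nA)) (trans balanced (sumFin≡sum nB)))
    (never-stuck G nA nB 0<ξ ξ≤1 0<α α≤ξ² minDeg nA-bounds nB-bounds)
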